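{- Let $q$ be an indeterminate (or a nonzero complex number that is not a root of unity), let $a,b$ be parameters and $n\ge0$. Then, as formal power series in $z$, $$\frac{z^n}{1-az}=\sum_{k\ge0}\frac{1}{[k]!}\bigl([n+k]a+q^{n+k}b\bigr)^k\,z^{n+k}\,E\Bigl(-q\bigl([n+k]a+q^{n+k}b\bigr)z\Bigr).$$
   Context: $[n]=\frac{1-q^n}{1-q}$, $[n]!=\prod_{j=1}^n[j]$, and $E(z)=\sum_{k\ge0}q^{\binom{k}{2}}\frac{z^k}{[k]!}$. -}

module Defs where

open import Level using (Level; _⊔_) renaming (suc to lsuc)
open import Data.Nat using (ℕ; zero; suc; _∸_; _<?_) renaming (_+_ to _+ℕ_)
open import Data.Nat.Combinatorics using (_C_)
open import Relation.Nullary using (¬_; yes; no)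
open import Algebra.Bundles using (CommutativeRing)

-- A field: a commutative ring with 0 ≠ 1 in which every nonzero element has an
-- inverse.  The inverse is a total operation (its value at 0 is irrelevant).
record Field (c ℓ : Level) : Set (lsuc (c ⊔ ℓ)) where
  field
    commutativeRing : CommutativeRing c ℓ
  open CommutativeRing commutativeRing public
  field
    _⁻¹       : Carrier → Carrier
    ⁻¹-cong   : ∀ {x y} → x ≈ y → x ⁻¹ ≈ y ⁻¹
    ⁻¹-inverse : ∀ x → ¬ (x ≈ 0#) → x * (x ⁻¹) ≈ 1#
    0≉1       : ¬ (0# ≈ 1#)

module FPS {c ℓ : Level} (K : Field c ℓ) where
  open Field K public using (Carrier; _≈_; _+_; _*_; -_; 0#; 1#; _-_; _⁻¹)

  pow : Carrier → ℕ → Carrier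
  pow x zero    = 1#
  pow x (suc n) = x * pow x n

  sumTo : (ℕ → Carrier) → ℕ → Carrier
  sumTo f zero    = f zero
  sumTo f (suc N) = sumTo f N + f (suc N)

  Series : Set c
  Series = ℕ → Carrier

  zpow : ℕ → Series
  zpow m N with N Data.Nat.≟ m
  ... | yes _ = 1#
  ... | no  _ = 0#

  scale : Carrier → Series → Series
  scale λ' f N = λ' * f N

  shift : ℕ → Series → Series
  shift m f N with N <? m
  ... | yes _ = 0#
  ... | no  _ = f (N ∸ m)

  _⊛_ : Series → Series → Series
  (f ⊛ g) N = sumTo (λ i → f i * g (N ∸ i)) N

  oneMinus : Carrier → Series
  oneMinus a zero          = 1#
  oneMinus a (suc zero)    = - a
  oneMinus a (suc (suc _)) = 0#

  -- Sum of a family of series T k in which T k has order ≥ k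
  -- (so only k ≤ N contribute to the coefficient of z^N).
  sumSeries : (ℕ → Series) → Series
  sumSeries T N = sumTo (λ k → T k N) N

  module _ (q : Carrier) where
    qint : ℕ → Carrier
    qint n = (1# - pow q n) * ((1# - q) ⁻¹)

    qfact : ℕ → Carrier
    qfact zero    = 1#
    qfact (suc n) = qfact n * qint (suc n)

    Eseries : Carrier → Series
    Eseries w j = pow q (j C 2) * pow w j * (qfact j ⁻¹)

    cc : ℕ → Carrier → Carrier → ℕ → Carrier
    cc n a b k = qint (n +ℕ k) * a + pow q (n +ℕ k) * b

    term : ℕ → Carrier → Carrier → ℕ → Series
    term n a b k =
      scale ((qfact k ⁻¹) * pow (cc n a b k) k)
            (shift (n +ℕ k) (Eseries (- (q * cc n a b k))))

    rhs : ℕ → Carrier → Carrier → Series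
    rhs n a b = sumSeries (term n a b)

-- With c_k = [n+k] a + q^(n+k) b, the coefficient of z^(n+m) on
-- the right is Σ_{k ≤ m} c_k^k (-q c_k)^(m-k) q^binom(m-k,2) / ([k]! [m-k]!),
-- and [m]! times it is the value at 0 of (T - q^m) ⋯ (T - q) applied to
-- k ↦ c_k^m, where T is the shift k ↦ k + 1 (q-binomial theorem).  Now
-- c_k = α + β q^k with α = a/(1-q), so c_k^m is a combination of the
-- geometric sequences (q^j)^k, j ≤ m; the operator multiplies (q^j)^k by
-- ∏_{1 ≤ i ≤ m} (q^j - q^i), which vanishes unless j = 0.  What is left is
-- α^m ∏_{1 ≤ i ≤ m} (1 - q^i) = [m]! a^m.  So the right side is Σ_m a^m z^(n+m),
-- i.e. z^n / (1 - a z).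

module Submission where

open import Defs
open import Algebra.Bundles using (CommutativeRing)
open import Algebra.Solver.Ring.AlmostCommutativeRing
  using (fromCommutativeRing; _-Raw-AlmostCommutative⟶_)
import Algebra.Properties.Ring as RingProperties
import Algebra.Properties.Semiring.Mult.TCOptimised as SemiringMult
import Algebra.Properties.CommutativeSemigroup as CommutativeSemigroupProperties
open import Data.Nat as ℕ using (ℕ; zero; suc; _≤_; _<_; z≤n; s≤s; _∸_; _<?_; _≟_)
import Data.Nat.Properties as ℕ
open import Data.Nat.Combinatorics using (_C_; nCk+nC[k+1]≡[n+1]C[k+1]; nC1≡n)
open import Data.Integer as ℤ using (ℤ; +_; -[1+_]; _⊖_; sign; ∣_∣; _◃_)
import Data.Integer.Properties as ℤ
open import Data.Sign as Sign using (Sign)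
open import Data.Maybe using (Maybe; just; nothing)
open import Data.Empty using (⊥-elim)
open import Relation.Nullary using (¬_; yes; no)
open import Relation.Binary.PropositionalEquality as ≡ using (_≡_)
open import Relation.Binary.Definitions using (Tri; tri<; tri≈; tri>)

-- Integer coefficients let the solver decide cancellations such as x - x = 0,
-- which it cannot do with the ring's own carrier as coefficients.
module IntegerCoefficientSolver {c ℓ} (R : CommutativeRing c ℓ) where
  open CommutativeRing R
  open SemiringMult semiring using (_×_; 1+×; ×-homo-+; ×1-homo-*)
  open RingProperties ring using (-‿involutive; -0#≈0#; -‿distribˡ-*; -‿+-comm)
  open CommutativeSemigroupProperties +-commutativeSemigroup using (interchange)
  open import Relation.Binary.Reasoning.Setoid setoid

  -- The type-checking-optimised multiple makes ι 1 reduce to 1#, so that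
  -- con (+ 1) is literally 1# in solver goals.
  ι : ℕ → Carrier
  ι n = n × 1#

  ⟦_⟧ᶻ : ℤ → Carrier
  ⟦ + n ⟧ᶻ      = ι n
  ⟦ -[1+ n ] ⟧ᶻ = - ι (suc n)

  ⟦⊖⟧ : ∀ m n → ⟦ m ⊖ n ⟧ᶻ ≈ ι m - ι n
  ⟦⊖⟧ zero    zero    = sym (trans (+-congˡ -0#≈0#) (+-identityʳ 0#))
  ⟦⊖⟧ (suc m) zero    = sym (trans (+-congˡ -0#≈0#) (+-identityʳ _))
  ⟦⊖⟧ zero    (suc n) = sym (+-identityˡ _)
  ⟦⊖⟧ (suc m) (suc n) = begin
    ⟦ suc m ⊖ suc n ⟧ᶻ           ≡⟨ ≡.cong ⟦_⟧ᶻ (ℤ.[1+m]⊖[1+n]≡m⊖n m n) ⟩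
    ⟦ m ⊖ n ⟧ᶻ                   ≈⟨ ⟦⊖⟧ m n ⟩
    ι m - ι n                    ≈⟨ +-identityˡ _ ⟨
    0# + (ι m - ι n)             ≈⟨ +-congʳ (-‿inverseʳ 1#) ⟨
    (1# - 1#) + (ι m - ι n)      ≈⟨ interchange 1# (- 1#) (ι m) (- ι n) ⟩
    (1# + ι m) + (- 1# - ι n)    ≈⟨ +-congˡ (-‿+-comm 1# (ι n)) ⟩
    (1# + ι m) - (1# + ι n)      ≈⟨ +-cong (1+× m 1#) (-‿cong (1+× n 1#)) ⟨
    ι (suc m) - ι (suc n)        ∎

  ⟦-⟧ : ∀ i → ⟦ ℤ.- i ⟧ᶻ ≈ - ⟦ i ⟧ᶻ
  ⟦-⟧ (+ zero)  = sym -0#≈0#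
  ⟦-⟧ (+ suc n) = refl
  ⟦-⟧ -[1+ n ]  = sym (-‿involutive _)

  ⟦+⟧ : ∀ i j → ⟦ i ℤ.+ j ⟧ᶻ ≈ ⟦ i ⟧ᶻ + ⟦ j ⟧ᶻ
  ⟦+⟧ (+ m)    (+ n)    = ×-homo-+ 1# m n
  ⟦+⟧ (+ m)    -[1+ n ] = ⟦⊖⟧ m (suc n)
  ⟦+⟧ -[1+ m ] (+ n)    = trans (⟦⊖⟧ n (suc m)) (+-comm _ _)
  ⟦+⟧ -[1+ m ] -[1+ n ] = begin
    - ι (suc (suc (m ℕ.+ n)))   ≡⟨ ≡.cong (λ k → - ι k) (ℕ.+-suc (suc m) n) ⟨
    - ι (suc m ℕ.+ suc n)       ≈⟨ -‿cong (×-homo-+ 1# (suc m) (suc n)) ⟩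
    - (ι (suc m) + ι (suc n))   ≈⟨ -‿+-comm _ _ ⟨
    - ι (suc m) - ι (suc n)     ∎

  ⟦_⟧ˢ : Sign → Carrier
  ⟦ Sign.+ ⟧ˢ = 1#
  ⟦ Sign.- ⟧ˢ = - 1#

  ⟦◃⟧ : ∀ s n → ⟦ s ◃ n ⟧ᶻ ≈ ⟦ s ⟧ˢ * ι n
  ⟦◃⟧ Sign.+ zero    = sym (*-identityˡ _)
  ⟦◃⟧ Sign.- zero    = sym (zeroʳ _)
  ⟦◃⟧ Sign.+ (suc n) = sym (*-identityˡ _)
  ⟦◃⟧ Sign.- (suc n) = trans (-‿cong (sym (*-identityˡ _))) (-‿distribˡ-* 1# _)

  ⟦sign*⟧ : ∀ s t → ⟦ s Sign.* t ⟧ˢ ≈ ⟦ s ⟧ˢ * ⟦ t ⟧ˢ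
  ⟦sign*⟧ Sign.+ t      = sym (*-identityˡ _)
  ⟦sign*⟧ Sign.- Sign.+ = sym (*-identityʳ _)
  ⟦sign*⟧ Sign.- Sign.- = sym (begin
    - 1# * - 1#    ≈⟨ -‿distribˡ-* 1# (- 1#) ⟨
    - (1# * - 1#)  ≈⟨ -‿cong (*-identityˡ _) ⟩
    - - 1#         ≈⟨ -‿involutive 1# ⟩
    1#             ∎)

  ⟦*⟧ : ∀ i j → ⟦ i ℤ.* j ⟧ᶻ ≈ ⟦ i ⟧ᶻ * ⟦ j ⟧ᶻ
  ⟦*⟧ i j = begin
    ⟦ s ◃ ∣ i ∣ ℕ.* ∣ j ∣ ⟧ᶻ                 ≈⟨ ⟦◃⟧ s (∣ i ∣ ℕ.* ∣ j ∣) ⟩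
    ⟦ s ⟧ˢ * ι (∣ i ∣ ℕ.* ∣ j ∣)             ≈⟨ *-cong (⟦sign*⟧ (sign i) (sign j)) (×1-homo-* ∣ i ∣ ∣ j ∣) ⟩
    (⟦ sign i ⟧ˢ * ⟦ sign j ⟧ˢ) * (ι ∣ i ∣ * ι ∣ j ∣)
      ≈⟨ interchange⋆ _ _ _ _ ⟩
    (⟦ sign i ⟧ˢ * ι ∣ i ∣) * (⟦ sign j ⟧ˢ * ι ∣ j ∣)
      ≈⟨ *-cong (⟦sign◃abs⟧ i) (⟦sign◃abs⟧ j) ⟨
    ⟦ i ⟧ᶻ * ⟦ j ⟧ᶻ                          ∎
    where
    s = sign i Sign.* sign j
    open CommutativeSemigroupProperties *-commutativeSemigroup
      using () renaming (interchange to interchange⋆)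
    ⟦sign◃abs⟧ : ∀ k → ⟦ k ⟧ᶻ ≈ ⟦ sign k ⟧ˢ * ι ∣ k ∣
    ⟦sign◃abs⟧ k = trans (reflexive (≡.cong ⟦_⟧ᶻ (≡.sym (ℤ.◃-inverse k)))) (⟦◃⟧ (sign k) ∣ k ∣)

  integerMorphism : ℤ.+-*-rawRing -Raw-AlmostCommutative⟶ fromCommutativeRing R
  integerMorphism = record
    { ⟦_⟧ = ⟦_⟧ᶻ ; +-homo = ⟦+⟧ ; *-homo = ⟦*⟧ ; -‿homo = ⟦-⟧ ; 0-homo = refl ; 1-homo = refl }

  ⟦⟧-weaklyDecidable : ∀ i j → Maybe (⟦ i ⟧ᶻ ≈ ⟦ j ⟧ᶻ)
  ⟦⟧-weaklyDecidable i j with i ℤ.≟ j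
  ... | yes ≡.refl = just refl
  ... | no _       = nothing

  open import Algebra.Solver.Ring _ (fromCommutativeRing R) integerMorphism ⟦⟧-weaklyDecidable public

module _ {c ℓ} (K : Field c ℓ) where
  open Field K hiding (zero)
  open FPS K using (pow; sumTo; Series; zpow; shift; oneMinus; qint; qfact; Eseries; cc; term; rhs; _⊛_)
  open IntegerCoefficientSolver commutativeRing using (solve; _:=_; _:+_; _:*_; _:-_; :-_; con)
  open RingProperties ring using (-‿distribˡ-*)
  open import Relation.Binary.Reasoning.Setoid setoid

  pow-+ : ∀ x i j → pow x (i ℕ.+ j) ≈ pow x i * pow x j
  pow-+ x zero    j = sym (*-identityˡ _)
  pow-+ x (suc i) j = trans (*-congˡ (pow-+ x i j)) (sym (*-assoc _ _ _))

  pow-* : ∀ x y k → pow (x * y) k ≈ pow x k * pow y k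
  pow-* x y zero    = sym (*-identityˡ _)
  pow-* x y (suc k) = trans (*-congˡ (pow-* x y k))
    (solve 4 (λ x y X Y → (x :* y) :* (X :* Y) := (x :* X) :* (y :* Y)) refl x y (pow x k) (pow y k))

  pow-pow : ∀ x i j → pow (pow x i) j ≈ pow x (i ℕ.* j)
  pow-pow x i zero    = reflexive (≡.cong (pow x) (≡.sym (ℕ.*-zeroʳ i)))
  pow-pow x i (suc j) = begin
    pow x i * pow (pow x i) j   ≈⟨ *-congˡ (pow-pow x i j) ⟩
    pow x i * pow x (i ℕ.* j)   ≈⟨ pow-+ x i (i ℕ.* j) ⟨
    pow x (i ℕ.+ i ℕ.* j)       ≡⟨ ≡.cong (pow x) (ℕ.*-suc i j) ⟨
    pow x (i ℕ.* suc j)         ∎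

  pow-pow-comm : ∀ x i j → pow (pow x i) j ≈ pow (pow x j) i
  pow-pow-comm x i j = begin
    pow (pow x i) j   ≈⟨ pow-pow x i j ⟩
    pow x (i ℕ.* j)   ≡⟨ ≡.cong (pow x) (ℕ.*-comm i j) ⟩
    pow x (j ℕ.* i)   ≈⟨ pow-pow x j i ⟨
    pow (pow x j) i   ∎

  pow-cong : ∀ {x y} k → x ≈ y → pow x k ≈ pow y k
  pow-cong zero    _   = refl
  pow-cong (suc k) x≈y = *-cong x≈y (pow-cong k x≈y)

  ⁻¹-cancelˡ : ∀ {x} y → ¬ (x ≈ 0#) → x ⁻¹ * (x * y) ≈ y
  ⁻¹-cancelˡ {x} y x≉0 = begin
    x ⁻¹ * (x * y) ≈⟨ solve 3 (λ x x' y → x' :* (x :* y) := (x :* x') :* y) refl x (x ⁻¹) y ⟩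
    (x * x ⁻¹) * y ≈⟨ *-congʳ (⁻¹-inverse x x≉0) ⟩
    1# * y         ≈⟨ *-identityˡ y ⟩
    y              ∎

  *-cancelˡ : ∀ {x y z} → ¬ (x ≈ 0#) → x * y ≈ x * z → y ≈ z
  *-cancelˡ {x} {y} {z} x≉0 xy≈xz = begin
    y              ≈⟨ ⁻¹-cancelˡ y x≉0 ⟨
    x ⁻¹ * (x * y) ≈⟨ *-congˡ xy≈xz ⟩
    x ⁻¹ * (x * z) ≈⟨ ⁻¹-cancelˡ z x≉0 ⟩
    z              ∎

  *-nonzero : ∀ {x y} → ¬ (x ≈ 0#) → ¬ (y ≈ 0#) → ¬ (x * y ≈ 0#)
  *-nonzero x≉0 y≉0 xy≈0 = y≉0 (*-cancelˡ x≉0 (trans xy≈0 (sym (zeroʳ _))))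

  ⁻¹-nonzero : ∀ {x} → ¬ (x ≈ 0#) → ¬ (x ⁻¹ ≈ 0#)
  ⁻¹-nonzero {x} x≉0 x⁻¹≈0 = 0≉1 (begin
    0#        ≈⟨ zeroʳ x ⟨
    x * 0#    ≈⟨ *-congˡ x⁻¹≈0 ⟨
    x * x ⁻¹  ≈⟨ ⁻¹-inverse x x≉0 ⟩
    1#        ∎)

  1-x≉0 : ∀ {x} → ¬ (x ≈ 1#) → ¬ (1# - x ≈ 0#)
  1-x≉0 {x} x≉1 1-x≈0 = x≉1 (begin
    x                ≈⟨ +-identityʳ x ⟨
    x + 0#           ≈⟨ +-congˡ 1-x≈0 ⟨
    x + (1# - x)     ≈⟨ solve 1 (λ x → x :+ (con (+ 1) :- x) := con (+ 1)) refl x ⟩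
    1#               ∎)

  sumTo-cong : ∀ {f g : ℕ → Carrier} N → (∀ i → i ≤ N → f i ≈ g i) → sumTo f N ≈ sumTo g N
  sumTo-cong zero    f≈g = f≈g zero z≤n
  sumTo-cong (suc N) f≈g =
    +-cong (sumTo-cong N (λ i i≤N → f≈g i (ℕ.m≤n⇒m≤1+n i≤N))) (f≈g (suc N) ℕ.≤-refl)

  sumTo-zero : ∀ {f : ℕ → Carrier} N → (∀ i → i ≤ N → f i ≈ 0#) → sumTo f N ≈ 0#
  sumTo-zero zero    f≈0 = f≈0 zero z≤n
  sumTo-zero (suc N) f≈0 = trans
    (+-cong (sumTo-zero N (λ i i≤N → f≈0 i (ℕ.m≤n⇒m≤1+n i≤N))) (f≈0 (suc N) ℕ.≤-refl))
    (+-identityʳ 0#)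

  sumTo-distrib-+ : ∀ (f g : ℕ → Carrier) N → sumTo (λ i → f i + g i) N ≈ sumTo f N + sumTo g N
  sumTo-distrib-+ f g zero    = refl
  sumTo-distrib-+ f g (suc N) = trans (+-congʳ (sumTo-distrib-+ f g N))
    (solve 4 (λ A B C D → (A :+ B) :+ (C :+ D) := (A :+ C) :+ (B :+ D)) refl _ _ _ _)

  sumTo-linear : ∀ x (f g : ℕ → Carrier) N →
    sumTo f N - x * sumTo g N ≈ sumTo (λ i → f i - x * g i) N
  sumTo-linear x f g zero    = refl
  sumTo-linear x f g (suc N) = trans
    (solve 5 (λ x A B C D → (A :+ B) :- x :* (C :+ D) := (A :- x :* C) :+ (B :- x :* D)) refl x _ _ _ _)
    (+-congʳ (sumTo-linear x f g N))

  *-distribˡ-sumTo : ∀ x (f : ℕ → Carrier) N → x * sumTo f N ≈ sumTo (λ i → x * f i) N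
  *-distribˡ-sumTo x f zero    = refl
  *-distribˡ-sumTo x f (suc N) = trans (distribˡ _ _ _) (+-congʳ (*-distribˡ-sumTo x f N))

  sumTo-unfoldˡ : ∀ (f : ℕ → Carrier) N → sumTo f (suc N) ≈ f 0 + sumTo (λ i → f (suc i)) N
  sumTo-unfoldˡ f zero    = refl
  sumTo-unfoldˡ f (suc N) = trans (+-congʳ (sumTo-unfoldˡ f N)) (+-assoc _ _ _)

  sumTo-extend : ∀ {f : ℕ → Carrier} M d → (∀ i → M < i → i ≤ M ℕ.+ d → f i ≈ 0#) →
    sumTo f (M ℕ.+ d) ≈ sumTo f M
  sumTo-extend {f} M zero    f≈0 = reflexive (≡.cong (sumTo f) (ℕ.+-identityʳ M))
  sumTo-extend {f} M (suc d) f≈0 = begin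
    sumTo f (M ℕ.+ suc d)                      ≡⟨ ≡.cong (sumTo f) (ℕ.+-suc M d) ⟩
    sumTo f (M ℕ.+ d) + f (suc (M ℕ.+ d))      ≈⟨ +-congˡ (f≈0 _ (s≤s (ℕ.m≤m+n M d)) (ℕ.≤-reflexive (≡.sym (ℕ.+-suc M d)))) ⟩
    sumTo f (M ℕ.+ d) + 0#                     ≈⟨ +-identityʳ _ ⟩
    sumTo f (M ℕ.+ d)                          ≈⟨ sumTo-extend M d (λ i M<i i≤M+d → f≈0 i M<i (ℕ.≤-trans i≤M+d (ℕ.+-monoʳ-≤ M (ℕ.n≤1+n d)))) ⟩
    sumTo f M                                  ∎

  sumTo-extend-by-zero : ∀ {f : ℕ → Carrier} N → f (suc N) ≈ 0# → sumTo f (suc N) ≈ sumTo f N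
  sumTo-extend-by-zero N f≈0 = trans (+-congˡ f≈0) (+-identityʳ _)

  shift-< : ∀ {m N} (f : Series) → N < m → shift m f N ≈ 0#
  shift-< {m} {N} f N<m with N <? m
  ... | yes _  = refl
  ... | no N≮m = ⊥-elim (N≮m N<m)

  shift-≥ : ∀ {m N} (f : Series) → m ≤ N → shift m f N ≈ f (N ∸ m)
  shift-≥ {m} {N} f m≤N with N <? m
  ... | yes N<m = ⊥-elim (ℕ.≤⇒≯ m≤N N<m)
  ... | no _    = refl

  zpow-≡ : ∀ {m N} → N ≡ m → zpow m N ≈ 1#
  zpow-≡ {m} {N} N≡m with N ≟ m
  ... | yes _  = refl
  ... | no N≢m = ⊥-elim (N≢m N≡m)

  zpow-≢ : ∀ {m N} → ¬ (N ≡ m) → zpow m N ≈ 0#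
  zpow-≢ {m} {N} N≢m with N ≟ m
  ... | yes N≡m = ⊥-elim (N≢m N≡m)
  ... | no _    = refl

  module _ (a : Carrier) where

    ⊛-oneMinus-zero : ∀ (f : Series) → (f ⊛ oneMinus a) 0 ≈ f 0
    ⊛-oneMinus-zero f = *-identityʳ (f 0)

    oneMinus-∸-≤ : ∀ {i M} → i ≤ M → oneMinus a (suc (suc M) ∸ i) ≈ 0#
    oneMinus-∸-≤ i≤M = reflexive (≡.cong (oneMinus a) (ℕ.+-∸-assoc 2 i≤M))

    oneMinus-suc-∸ : ∀ M → oneMinus a (suc M ∸ M) ≈ - a
    oneMinus-suc-∸ M = reflexive (≡.cong (oneMinus a) (≡.trans (ℕ.+-∸-assoc 1 (ℕ.≤-refl {M})) (≡.cong suc (ℕ.n∸n≡0 M))))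

    ⊛-oneMinus-suc : ∀ (f : Series) N → (f ⊛ oneMinus a) (suc N) ≈ f (suc N) - a * f N
    ⊛-oneMinus-suc f N = begin
      sumTo (λ i → f i * oneMinus a (suc N ∸ i)) N + f (suc N) * oneMinus a (N ∸ N)
        ≈⟨ +-cong (all-but-top N) (*-congˡ (reflexive (≡.cong (oneMinus a) (ℕ.n∸n≡0 N)))) ⟩
      - (a * f N) + f (suc N) * 1#
        ≈⟨ solve 3 (λ a g h → :- (a :* g) :+ h :* con (+ 1) := h :- a :* g) refl a (f N) (f (suc N)) ⟩
      f (suc N) - a * f N ∎
      where
      all-but-top : ∀ M → sumTo (λ i → f i * oneMinus a (suc M ∸ i)) M ≈ - (a * f M)
      all-but-top zero    = solve 2 (λ g a → g :* (:- a) := :- (a :* g)) refl (f 0) a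
      all-but-top (suc M) = begin
        sumTo (λ i → f i * oneMinus a (suc (suc M) ∸ i)) M + f (suc M) * oneMinus a (suc M ∸ M)
          ≈⟨ +-cong (sumTo-zero M (λ i i≤M → trans (*-congˡ (oneMinus-∸-≤ i≤M)) (zeroʳ _))) (*-congˡ (oneMinus-suc-∸ M)) ⟩
        0# + f (suc M) * (- a)
          ≈⟨ solve 2 (λ g a → con (+ 0) :+ g :* (:- a) := :- (a :* g)) refl (f (suc M)) a ⟩
        - (a * f (suc M)) ∎

    ⊛-oneMinus-shifted-geometric : ∀ (f : Series) n → (∀ N → N < n → f N ≈ 0#) →
      (∀ m → f (n ℕ.+ m) ≈ pow a m) → ∀ N → (f ⊛ oneMinus a) N ≈ zpow n N
    ⊛-oneMinus-shifted-geometric f zero    below from zero =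
      trans (⊛-oneMinus-zero f) (trans (from 0) (sym (zpow-≡ {0} ≡.refl)))
    ⊛-oneMinus-shifted-geometric f (suc n) below from zero =
      trans (⊛-oneMinus-zero f) (trans (below 0 (s≤s z≤n)) (sym (zpow-≢ {suc n} {0} (λ ()))))
    ⊛-oneMinus-shifted-geometric f n below from (suc N) =
      trans (⊛-oneMinus-suc f N) (compare (ℕ.<-cmp (suc N) n))
      where
      f-at : ∀ {M} m → M ≡ n ℕ.+ m → f M ≈ pow a m
      f-at m ≡.refl = from m
      compare : Tri (suc N < n) (suc N ≡ n) (n < suc N) → f (suc N) - a * f N ≈ zpow n (suc N)
      compare (tri< 1+N<n 1+N≢n _) = begin
        f (suc N) - a * f N  ≈⟨ +-cong (below (suc N) 1+N<n) (-‿cong (*-congˡ (below N (ℕ.<-trans (ℕ.n<1+n N) 1+N<n)))) ⟩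
        0# - a * 0#          ≈⟨ solve 1 (λ a → con (+ 0) :- a :* con (+ 0) := con (+ 0)) refl a ⟩
        0#                   ≈⟨ zpow-≢ 1+N≢n ⟨
        zpow n (suc N)       ∎
      compare (tri≈ _ 1+N≡n _) = begin
        f (suc N) - a * f N  ≈⟨ +-cong (f-at 0 (≡.trans 1+N≡n (≡.sym (ℕ.+-identityʳ n)))) (-‿cong (*-congˡ (below N (ℕ.≤-reflexive 1+N≡n)))) ⟩
        1# - a * 0#          ≈⟨ solve 1 (λ a → con (+ 1) :- a :* con (+ 0) := con (+ 1)) refl a ⟩
        1#                   ≈⟨ zpow-≡ 1+N≡n ⟨
        zpow n (suc N)       ∎
      compare (tri> _ 1+N≢n n<1+N) = begin
        f (suc N) - a * f N        ≈⟨ +-cong (f-at (suc m) (≡.trans (≡.cong suc N≡n+m) (≡.sym (ℕ.+-suc n m)))) (-‿cong (*-congˡ (f-at m N≡n+m))) ⟩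
        a * pow a m - a * pow a m  ≈⟨ -‿inverseʳ _ ⟩
        0#                         ≈⟨ zpow-≢ 1+N≢n ⟨
        zpow n (suc N)             ∎
        where
        m = N ∸ n
        N≡n+m : N ≡ n ℕ.+ m
        N≡n+m = ≡.sym (ℕ.m+[n∸m]≡n (ℕ.≤-pred n<1+N))

  affineCoeff : Carrier → Carrier → ℕ → ℕ → Carrier
  affineCoeff α β zero    zero    = 1#
  affineCoeff α β zero    (suc j) = 0#
  affineCoeff α β (suc m) zero    = α * affineCoeff α β m zero
  affineCoeff α β (suc m) (suc j) = α * affineCoeff α β m (suc j) + β * affineCoeff α β m j

  module _ (α β : Carrier) where
    private
      P = affineCoeff α β

    affineCoeff-> : ∀ m j → m < j → P m j ≈ 0#
    affineCoeff-> zero    (suc j) _         = refl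
    affineCoeff-> (suc m) (suc j) (s≤s m<j) = begin
      α * P m (suc j) + β * P m j  ≈⟨ +-cong (*-congˡ (affineCoeff-> m (suc j) (ℕ.m≤n⇒m≤1+n m<j))) (*-congˡ (affineCoeff-> m j m<j)) ⟩
      α * 0# + β * 0#              ≈⟨ solve 2 (λ α β → α :* con (+ 0) :+ β :* con (+ 0) := con (+ 0)) refl α β ⟩
      0#                           ∎

    affineCoeff-zero : ∀ m → P m 0 ≈ pow α m
    affineCoeff-zero zero    = refl
    affineCoeff-zero (suc m) = *-congˡ (affineCoeff-zero m)

    pow-affine-expand : ∀ m x → pow (α + β * x) m ≈ sumTo (λ j → P m j * pow x j) m
    pow-affine-expand zero    x = sym (*-identityʳ 1#)
    pow-affine-expand (suc m) x = begin
      (α + β * x) * pow (α + β * x) m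
        ≈⟨ *-congˡ (pow-affine-expand m x) ⟩
      (α + β * x) * S
        ≈⟨ solve 4 (λ α β x S → (α :+ β :* x) :* S := α :* S :+ β :* (x :* S)) refl α β x S ⟩
      α * S + β * (x * S)
        ≈⟨ +-cong (*-congˡ (sym S-extend)) (*-congˡ (*-distribˡ-sumTo x _ m)) ⟩
      α * sumTo (λ j → P m j * pow x j) (suc m) + β * sumTo (λ j → x * (P m j * pow x j)) m
        ≈⟨ +-cong (*-congˡ (sumTo-unfoldˡ _ m)) (*-distribˡ-sumTo β _ m) ⟩
      α * (P m 0 * 1# + sumTo (λ j → P m (suc j) * pow x (suc j)) m) + sumTo (λ j → β * (x * (P m j * pow x j))) m
        ≈⟨ solve 4 (λ α A B C → α :* (A :+ B) :+ C := α :* A :+ (α :* B :+ C)) refl α _ _ _ ⟩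
      α * (P m 0 * 1#) + (α * sumTo (λ j → P m (suc j) * pow x (suc j)) m + sumTo (λ j → β * (x * (P m j * pow x j))) m)
        ≈⟨ +-cong (sym (*-assoc _ _ _)) (+-congʳ (*-distribˡ-sumTo α _ m)) ⟩
      P (suc m) 0 * 1# + (sumTo (λ j → α * (P m (suc j) * pow x (suc j))) m + sumTo (λ j → β * (x * (P m j * pow x j))) m)
        ≈⟨ +-congˡ (sym (sumTo-distrib-+ _ _ m)) ⟩
      P (suc m) 0 * 1# + sumTo (λ j → α * (P m (suc j) * pow x (suc j)) + β * (x * (P m j * pow x j))) m
        ≈⟨ +-congˡ (sumTo-cong m (λ j _ → solve 6 (λ α β x A B X → α :* (A :* (x :* X)) :+ β :* (x :* (B :* X)) := (α :* A :+ β :* B) :* (x :* X)) refl α β x (P m (suc j)) (P m j) (pow x j))) ⟩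
      P (suc m) 0 * 1# + sumTo (λ j → P (suc m) (suc j) * pow x (suc j)) m
        ≈⟨ sumTo-unfoldˡ _ m ⟨
      sumTo (λ j → P (suc m) j * pow x j) (suc m) ∎
      where
      S = sumTo (λ j → P m j * pow x j) m
      S-extend : sumTo (λ j → P m j * pow x j) (suc m) ≈ S
      S-extend = sumTo-extend-by-zero m (trans (*-congʳ (affineCoeff-> m (suc m) ℕ.≤-refl)) (zeroˡ _))

  module _ (q : Carrier) where

    -- qDiff m f is the value at 0 of (T - q^m) ⋯ (T - q) f, where T f = f ∘ suc.
    qDiff : ℕ → (ℕ → Carrier) → Carrier
    qDiff zero    f = f 0
    qDiff (suc m) f = qDiff m (λ k → f (suc k)) - pow q (suc m) * qDiff m f

    qDiff-cong : ∀ m {f g : ℕ → Carrier} → (∀ k → f k ≈ g k) → qDiff m f ≈ qDiff m g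
    qDiff-cong zero    f≈g = f≈g 0
    qDiff-cong (suc m) f≈g = +-cong (qDiff-cong m (λ k → f≈g (suc k))) (-‿cong (*-congˡ (qDiff-cong m f≈g)))

    qDiff-+ : ∀ m (f g : ℕ → Carrier) → qDiff m (λ k → f k + g k) ≈ qDiff m f + qDiff m g
    qDiff-+ zero    f g = refl
    qDiff-+ (suc m) f g = trans (+-cong (qDiff-+ m _ _) (-‿cong (*-congˡ (qDiff-+ m f g))))
      (solve 5 (λ A B C D p → (A :+ B) :- p :* (C :+ D) := (A :- p :* C) :+ (B :- p :* D)) refl _ _ _ _ _)

    qDiff-*ˡ : ∀ m x (f : ℕ → Carrier) → qDiff m (λ k → x * f k) ≈ x * qDiff m f
    qDiff-*ˡ zero    x f = refl
    qDiff-*ˡ (suc m) x f = trans (+-cong (qDiff-*ˡ m x _) (-‿cong (*-congˡ (qDiff-*ˡ m x f))))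
      (solve 4 (λ x A C p → x :* A :- p :* (x :* C) := x :* (A :- p :* C)) refl _ _ _ _)

    qDiff-sumTo : ∀ m (h : ℕ → ℕ → Carrier) d →
      qDiff m (λ k → sumTo (λ j → h j k) d) ≈ sumTo (λ j → qDiff m (h j)) d
    qDiff-sumTo m h zero    = refl
    qDiff-sumTo m h (suc d) = trans (qDiff-+ m _ _) (+-congʳ (qDiff-sumTo m h d))

    qProduct : Carrier → ℕ → Carrier
    qProduct r zero    = 1#
    qProduct r (suc m) = (r - pow q (suc m)) * qProduct r m

    qDiff-geometric : ∀ m r → qDiff m (pow r) ≈ qProduct r m
    qDiff-geometric zero    r = refl
    qDiff-geometric (suc m) r = begin
      qDiff m (λ k → r * pow r k) - pow q (suc m) * qDiff m (pow r)
        ≈⟨ +-cong (trans (qDiff-*ˡ m r (pow r)) (*-congˡ (qDiff-geometric m r))) (-‿cong (*-congˡ (qDiff-geometric m r))) ⟩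
      r * qProduct r m - pow q (suc m) * qProduct r m
        ≈⟨ solve 3 (λ r P p → r :* P :- p :* P := (r :- p) :* P) refl r (qProduct r m) (pow q (suc m)) ⟩
      (r - pow q (suc m)) * qProduct r m ∎

    qProduct-root : ∀ {j} m → 1 ≤ j → j ≤ m → qProduct (pow q j) m ≈ 0#
    qProduct-root zero    (s≤s _) ()
    qProduct-root {j} (suc m) 1≤j j≤1+m with j ≟ suc m
    ... | yes ≡.refl = trans (*-congʳ (-‿inverseʳ _)) (zeroˡ _)
    ... | no  j≢1+m  = trans (*-congˡ (qProduct-root m 1≤j (ℕ.≤-pred (ℕ.≤∧≢⇒< j≤1+m j≢1+m)))) (zeroʳ _)

    qDiff-pow-affine : ∀ α β m → qDiff m (λ k → pow (α + β * pow q k) m) ≈ pow α m * qProduct 1# m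
    qDiff-pow-affine α β m = begin
      qDiff m (λ k → pow (α + β * pow q k) m)
        ≈⟨ qDiff-cong m (λ k → trans (pow-affine-expand α β m (pow q k))
                                     (sumTo-cong m (λ j _ → *-congˡ (pow-pow-comm q k j)))) ⟩
      qDiff m (λ k → sumTo (λ j → P j * pow (pow q j) k) m)
        ≈⟨ qDiff-sumTo m (λ j k → P j * pow (pow q j) k) m ⟩
      sumTo (λ j → qDiff m (λ k → P j * pow (pow q j) k)) m
        ≈⟨ sumTo-cong m (λ j _ → trans (qDiff-*ˡ m (P j) _) (*-congˡ (qDiff-geometric m (pow q j)))) ⟩
      sumTo (λ j → P j * qProduct (pow q j) m) m
        ≈⟨ sumTo-extend 0 m (λ j 0<j j≤m → trans (*-congˡ (qProduct-root m 0<j j≤m)) (zeroʳ _)) ⟩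
      P 0 * qProduct 1# m
        ≈⟨ *-congʳ (affineCoeff-zero α β m) ⟩
      pow α m * qProduct 1# m ∎
      where
      P = affineCoeff α β m

    qBinom : ℕ → ℕ → Carrier
    qBinom zero    zero    = 1#
    qBinom zero    (suc k) = 0#
    qBinom (suc m) zero    = 1#
    qBinom (suc m) (suc k) = pow q (suc k) * qBinom m (suc k) + qBinom m k

    qBinom-> : ∀ m k → m < k → qBinom m k ≈ 0#
    qBinom-> zero    (suc k) _         = refl
    qBinom-> (suc m) (suc k) (s≤s m<k) = begin
      pow q (suc k) * qBinom m (suc k) + qBinom m k
        ≈⟨ +-cong (*-congˡ (qBinom-> m (suc k) (ℕ.m≤n⇒m≤1+n m<k))) (qBinom-> m k m<k) ⟩
      pow q (suc k) * 0# + 0#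
        ≈⟨ solve 1 (λ p → p :* con (+ 0) :+ con (+ 0) := con (+ 0)) refl (pow q (suc k)) ⟩
      0# ∎

    qBinom-zero : ∀ m → qBinom m 0 ≈ 1#
    qBinom-zero zero    = refl
    qBinom-zero (suc m) = refl

    qSign : ℕ → Carrier
    qSign l = pow (- q) l * pow q (l C 2)

    qSign-suc : ∀ l → qSign (suc l) ≈ - pow q (suc l) * qSign l
    qSign-suc l = begin
      (- q * pow (- q) l) * pow q (suc l C 2)         ≡⟨ ≡.cong (λ e → (- q * pow (- q) l) * pow q e) (binom-suc l) ⟩
      (- q * pow (- q) l) * pow q (l ℕ.+ l C 2)       ≈⟨ *-congˡ (pow-+ q l (l C 2)) ⟩
      (- q * pow (- q) l) * (pow q l * pow q (l C 2))
        ≈⟨ solve 4 (λ q N L C → ((:- q) :* N) :* (L :* C) := (:- (q :* L)) :* (N :* C)) refl q (pow (- q) l) (pow q l) (pow q (l C 2)) ⟩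
      - pow q (suc l) * qSign l                        ∎
      where
      binom-suc : ∀ l → suc l C 2 ≡ l ℕ.+ l C 2
      binom-suc l = ≡.trans (≡.sym (nCk+nC[k+1]≡[n+1]C[k+1] l 1)) (≡.cong (ℕ._+ l C 2) (nC1≡n l))

    qSign-shift : ∀ m k → k < m → qSign (m ∸ k) * pow q (suc k) ≈ - pow q (suc m) * qSign (m ∸ suc k)
    qSign-shift m k k<m = begin
      qSign (m ∸ k) * pow q (suc k)                   ≡⟨ ≡.cong (λ e → qSign e * pow q (suc k)) (ℕ.+-∸-assoc 1 k<m) ⟩
      qSign (suc l) * pow q (suc k)                   ≈⟨ *-congʳ (qSign-suc l) ⟩
      - pow q (suc l) * qSign l * pow q (suc k)
        ≈⟨ solve 3 (λ A S B → (:- A) :* S :* B := :- (A :* B) :* S) refl (pow q (suc l)) (qSign l) (pow q (suc k)) ⟩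
      - (pow q (suc l) * pow q (suc k)) * qSign l     ≈⟨ *-congʳ (-‿cong (pow-+ q (suc l) (suc k))) ⟨
      - pow q (suc (l ℕ.+ suc k)) * qSign l           ≡⟨ ≡.cong (λ e → - pow q (suc e) * qSign l) (ℕ.m∸n+n≡m k<m) ⟩
      - pow q (suc m) * qSign l                       ∎
      where
      l = m ∸ suc k

    qCoeff : ℕ → ℕ → Carrier
    qCoeff m k = qSign (m ∸ k) * qBinom m k

    qCoeff-suc-zero : ∀ m → qCoeff (suc m) 0 ≈ - pow q (suc m) * qCoeff m 0
    qCoeff-suc-zero m = begin
      qSign (suc m) * 1#                   ≈⟨ *-identityʳ _ ⟩
      qSign (suc m)                        ≈⟨ qSign-suc m ⟩
      - pow q (suc m) * qSign m            ≈⟨ *-congˡ (trans (*-congˡ (qBinom-zero m)) (*-identityʳ _)) ⟨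
      - pow q (suc m) * (qSign m * qBinom m 0) ∎

    qCoeff-suc : ∀ m k → qCoeff (suc m) (suc k) ≈ qCoeff m k - pow q (suc m) * qCoeff m (suc k)
    qCoeff-suc m k = begin
      qSign (m ∸ k) * (pow q (suc k) * qBinom m (suc k) + qBinom m k)
        ≈⟨ solve 4 (λ S p B C → S :* (p :* B :+ C) := S :* C :+ (S :* p) :* B) refl (qSign (m ∸ k)) (pow q (suc k)) (qBinom m (suc k)) (qBinom m k) ⟩
      qCoeff m k + (qSign (m ∸ k) * pow q (suc k)) * qBinom m (suc k)
        ≈⟨ +-congˡ shifted ⟩
      qCoeff m k - pow q (suc m) * qCoeff m (suc k) ∎
      where
      shifted : (qSign (m ∸ k) * pow q (suc k)) * qBinom m (suc k) ≈ - (pow q (suc m) * qCoeff m (suc k))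
      shifted with k <? m
      ... | yes k<m = trans (*-congʳ (qSign-shift m k k<m))
        (solve 3 (λ p S B → (:- p :* S) :* B := :- (p :* (S :* B))) refl (pow q (suc m)) (qSign (m ∸ suc k)) (qBinom m (suc k)))
      ... | no  k≮m = begin
        (qSign (m ∸ k) * pow q (suc k)) * qBinom m (suc k)     ≈⟨ *-congˡ B≈0 ⟩
        (qSign (m ∸ k) * pow q (suc k)) * 0#
          ≈⟨ solve 4 (λ S p P T → (S :* p) :* con (+ 0) := :- (P :* (T :* con (+ 0)))) refl (qSign (m ∸ k)) (pow q (suc k)) (pow q (suc m)) (qSign (m ∸ suc k)) ⟩
        - (pow q (suc m) * (qSign (m ∸ suc k) * 0#))           ≈⟨ -‿cong (*-congˡ (*-congˡ B≈0)) ⟨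
        - (pow q (suc m) * qCoeff m (suc k))                   ∎
        where
        B≈0 = qBinom-> m (suc k) (s≤s (ℕ.≮⇒≥ k≮m))

    qDiff-expansion : ∀ m f → qDiff m f ≈ sumTo (λ k → qCoeff m k * f k) m
    qDiff-expansion zero    f = sym (trans (*-congʳ (trans (*-identityʳ _) (*-identityʳ 1#))) (*-identityˡ (f 0)))
    qDiff-expansion (suc m) f = begin
      qDiff m (λ k → f (suc k)) - p * qDiff m f
        ≈⟨ +-cong (qDiff-expansion m _) (-‿cong (*-congˡ (qDiff-expansion m f))) ⟩
      S₁ - p * sumTo (λ k → qCoeff m k * f k) m
        ≈⟨ +-congˡ (-‿cong (*-congˡ (sumTo-extend-by-zero m (trans (*-congʳ (trans (*-congˡ (qBinom-> m (suc m) ℕ.≤-refl)) (zeroʳ _))) (zeroˡ _))))) ⟨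
      S₁ - p * sumTo (λ k → qCoeff m k * f k) (suc m)
        ≈⟨ +-congˡ (-‿cong (*-congˡ (sumTo-unfoldˡ _ m))) ⟩
      S₁ - p * (qCoeff m 0 * f 0 + sumTo (λ k → qCoeff m (suc k) * f (suc k)) m)
        ≈⟨ solve 4 (λ S p A B → S :- p :* (A :+ B) := (:- p) :* A :+ (S :- p :* B)) refl S₁ p _ _ ⟩
      - p * (qCoeff m 0 * f 0) + (S₁ - p * sumTo (λ k → qCoeff m (suc k) * f (suc k)) m)
        ≈⟨ +-cong (trans (sym (*-assoc _ _ _)) (*-congʳ (sym (qCoeff-suc-zero m)))) (sumTo-linear p _ _ m) ⟩
      qCoeff (suc m) 0 * f 0 + sumTo (λ k → qCoeff m k * f (suc k) - p * (qCoeff m (suc k) * f (suc k))) m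
        ≈⟨ +-congˡ (sumTo-cong m (λ k _ → trans
             (solve 4 (λ A p B F → A :* F :- p :* (B :* F) := (A :- p :* B) :* F) refl (qCoeff m k) p (qCoeff m (suc k)) (f (suc k)))
             (*-congʳ (sym (qCoeff-suc m k))))) ⟩
      qCoeff (suc m) 0 * f 0 + sumTo (λ k → qCoeff (suc m) (suc k) * f (suc k)) m
        ≈⟨ sumTo-unfoldˡ _ m ⟨
      sumTo (λ k → qCoeff (suc m) k * f k) (suc m) ∎
      where
      p = pow q (suc m)
      S₁ = sumTo (λ k → qCoeff m k * f (suc k)) m

    qint-+ : ∀ i j → qint q (i ℕ.+ j) ≈ qint q i + pow q i * qint q j
    qint-+ i j = begin
      (1# - pow q (i ℕ.+ j)) * (1# - q) ⁻¹         ≈⟨ *-congʳ (+-congˡ (-‿cong (pow-+ q i j))) ⟩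
      (1# - pow q i * pow q j) * (1# - q) ⁻¹
        ≈⟨ solve 3 (λ A B I → (con (+ 1) :- A :* B) :* I := (con (+ 1) :- A) :* I :+ A :* ((con (+ 1) :- B) :* I)) refl (pow q i) (pow q j) ((1# - q) ⁻¹) ⟩
      qint q i + pow q i * qint q j                  ∎

    qint-zero : qint q 0 ≈ 0#
    qint-zero = trans (*-congʳ (-‿inverseʳ 1#)) (zeroˡ _)

    qBinom-qfact : ∀ m k → k ≤ m → qBinom m k * (qfact q k * qfact q (m ∸ k)) ≈ qfact q m
    qBinom-qfact zero    zero    _         = trans (*-identityˡ _) (*-identityˡ _)
    qBinom-qfact (suc m) zero    _         = trans (*-identityˡ _) (*-identityˡ _)
    qBinom-qfact (suc m) (suc k) (s≤s k≤m) = begin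
      (p * qBinom m (suc k) + qBinom m k) * (qfact q (suc k) * qfact q (m ∸ k))
        ≈⟨ solve 6 (λ p B₁ B₀ F I G → (p :* B₁ :+ B₀) :* ((F :* I) :* G) := p :* (B₁ :* ((F :* I) :* G)) :+ (B₀ :* (F :* G)) :* I) refl
             p (qBinom m (suc k)) (qBinom m k) (qfact q k) (qint q (suc k)) (qfact q (m ∸ k)) ⟩
      p * (qBinom m (suc k) * (qfact q (suc k) * qfact q (m ∸ k))) + (qBinom m k * (qfact q k * qfact q (m ∸ k))) * qint q (suc k)
        ≈⟨ +-cong (*-congˡ qBinom-suc-qfact) (*-congʳ (qBinom-qfact m k k≤m)) ⟩
      p * (qfact q m * qint q (m ∸ k)) + qfact q m * qint q (suc k)
        ≈⟨ solve 4 (λ p F A B → p :* (F :* A) :+ F :* B := F :* (B :+ p :* A)) refl p (qfact q m) (qint q (m ∸ k)) (qint q (suc k)) ⟩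
      qfact q m * (qint q (suc k) + p * qint q (m ∸ k))
        ≈⟨ *-congˡ (qint-+ (suc k) (m ∸ k)) ⟨
      qfact q m * qint q (suc k ℕ.+ (m ∸ k))
        ≡⟨ ≡.cong (λ e → qfact q m * qint q (suc e)) (ℕ.m+[n∸m]≡n k≤m) ⟩
      qfact q m * qint q (suc m) ∎
      where
      p = pow q (suc k)
      qBinom-suc-qfact : qBinom m (suc k) * (qfact q (suc k) * qfact q (m ∸ k)) ≈ qfact q m * qint q (m ∸ k)
      qBinom-suc-qfact with k <? m
      ... | yes k<m = begin
        qBinom m (suc k) * (qfact q (suc k) * qfact q (m ∸ k))
          ≡⟨ ≡.cong (λ e → qBinom m (suc k) * (qfact q (suc k) * qfact q e)) (ℕ.+-∸-assoc 1 k<m) ⟩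
        qBinom m (suc k) * (qfact q (suc k) * (qfact q l * qint q (suc l)))
          ≈⟨ solve 4 (λ B F G J → B :* (F :* (G :* J)) := B :* (F :* G) :* J) refl (qBinom m (suc k)) (qfact q (suc k)) (qfact q l) (qint q (suc l)) ⟩
        qBinom m (suc k) * (qfact q (suc k) * qfact q l) * qint q (suc l)
          ≈⟨ *-congʳ (qBinom-qfact m (suc k) k<m) ⟩
        qfact q m * qint q (suc l)
          ≡⟨ ≡.cong (λ e → qfact q m * qint q e) (ℕ.+-∸-assoc 1 k<m) ⟨
        qfact q m * qint q (m ∸ k) ∎
        where
        l = m ∸ suc k
      ... | no k≮m = begin
        qBinom m (suc k) * (qfact q (suc k) * qfact q (m ∸ k))  ≈⟨ *-congʳ (qBinom-> m (suc k) (s≤s (ℕ.≮⇒≥ k≮m))) ⟩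
        0# * (qfact q (suc k) * qfact q (m ∸ k))                ≈⟨ zeroˡ _ ⟩
        0#                                                      ≈⟨ zeroʳ _ ⟨
        qfact q m * 0#                                          ≈⟨ *-congˡ (trans (reflexive (≡.cong (qint q) m∸k≡0)) qint-zero) ⟨
        qfact q m * qint q (m ∸ k)                              ∎
        where
        m∸k≡0 : m ∸ k ≡ 0
        m∸k≡0 = ≡.trans (≡.cong (m ∸_) (ℕ.≤-antisym k≤m (ℕ.≮⇒≥ k≮m))) (ℕ.n∸n≡0 m)

    qProduct-1# : ∀ m → pow ((1# - q) ⁻¹) m * qProduct 1# m ≈ qfact q m
    qProduct-1# zero    = *-identityˡ 1#
    qProduct-1# (suc m) = begin
      (ι * pow ι m) * ((1# - pow q (suc m)) * qProduct 1# m)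
        ≈⟨ solve 4 (λ ι J p P → (ι :* J) :* ((con (+ 1) :- p) :* P) := (J :* P) :* ((con (+ 1) :- p) :* ι)) refl ι (pow ι m) (pow q (suc m)) (qProduct 1# m) ⟩
      (pow ι m * qProduct 1# m) * qint q (suc m)
        ≈⟨ *-congʳ (qProduct-1# m) ⟩
      qfact q m * qint q (suc m) ∎
      where
      ι = (1# - q) ⁻¹

  module _ (q a b : Carrier) (n : ℕ) where

    rhsCoeff : ℕ → ℕ → Carrier
    rhsCoeff m k = (qfact q k ⁻¹ * pow (cc q n a b k) k) * Eseries q (- (q * cc q n a b k)) (m ∸ k)

    rhs-below : ∀ N → N < n → rhs q n a b N ≈ 0#
    rhs-below N N<n = sumTo-zero N (λ k _ →
      trans (*-congˡ (shift-< _ (ℕ.<-≤-trans N<n (ℕ.m≤m+n n k)))) (zeroʳ _))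

    rhs-above : ∀ m → rhs q n a b (n ℕ.+ m) ≈ sumTo (rhsCoeff m) m
    rhs-above m = begin
      sumTo summand (n ℕ.+ m)   ≡⟨ ≡.cong (sumTo summand) (ℕ.+-comm n m) ⟩
      sumTo summand (m ℕ.+ n)   ≈⟨ sumTo-extend m n (λ k m<k _ → trans (*-congˡ (shift-< _ (ℕ.+-monoʳ-< n m<k))) (zeroʳ _)) ⟩
      sumTo summand m           ≈⟨ sumTo-cong m (λ k k≤m → *-congˡ (trans (shift-≥ _ (ℕ.+-monoʳ-≤ n k≤m))
                                     (reflexive (≡.cong (Eseries q _) (ℕ.[m+n]∸[m+o]≡n∸o n m k))))) ⟩
      sumTo (rhsCoeff m) m      ∎
      where
      summand : ℕ → Carrier
      summand k = term q n a b k (n ℕ.+ m)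

    cc-affine : ∀ k → cc q n a b k ≈ a * (1# - q) ⁻¹ + (pow q n * (b - a * (1# - q) ⁻¹)) * pow q k
    cc-affine k = begin
      (1# - pow q (n ℕ.+ k)) * ι * a + pow q (n ℕ.+ k) * b
        ≈⟨ +-cong (*-congʳ (*-congʳ (+-congˡ (-‿cong (pow-+ q n k))))) (*-congʳ (pow-+ q n k)) ⟩
      (1# - pow q n * pow q k) * ι * a + pow q n * pow q k * b
        ≈⟨ solve 5 (λ A B ι a b → (con (+ 1) :- A :* B) :* ι :* a :+ A :* B :* b := a :* ι :+ (A :* (b :- a :* ι)) :* B) refl (pow q n) (pow q k) ι a b ⟩
      a * ι + (pow q n * (b - a * ι)) * pow q k ∎
      where
      ι = (1# - q) ⁻¹

  module _ {q : Carrier} (q-not-root-of-unity : ∀ m → ¬ (pow q (suc m) ≈ 1#)) where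

    qfact≉0 : ∀ m → ¬ (qfact q m ≈ 0#)
    qfact≉0 zero    1≈0 = 0≉1 (sym 1≈0)
    qfact≉0 (suc m)     =
      *-nonzero (qfact≉0 m) (*-nonzero (1-x≉0 (q-not-root-of-unity m)) (⁻¹-nonzero (1-x≉0 q≉1)))
      where
      q≉1 : ¬ (q ≈ 1#)
      q≉1 q≈1 = q-not-root-of-unity 0 (trans (*-identityʳ q) q≈1)

    qfact-*-Eseries : ∀ x {m k} → k ≤ m →
      qfact q m * ((qfact q k ⁻¹ * pow x k) * Eseries q (- (q * x)) (m ∸ k)) ≈ qCoeff q m k * pow x m
    qfact-*-Eseries x {m} {k} k≤m = begin
      qfact q m * ((F ⁻¹ * pow x k) * (pow q (l C 2) * pow (- (q * x)) l * G ⁻¹))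
        ≈⟨ *-cong (sym (qBinom-qfact q m k k≤m)) (*-congˡ (*-congʳ (*-congˡ -qx^l))) ⟩
      (qBinom q m k * (F * G)) * ((F ⁻¹ * pow x k) * (pow q (l C 2) * (pow (- q) l * pow x l) * G ⁻¹))
        ≈⟨ solve 9 (λ B F G F' X C N Y G' → (B :* (F :* G)) :* ((F' :* X) :* (C :* (N :* Y) :* G')) := (F :* F') :* (G :* G') :* ((N :* C) :* B :* (X :* Y))) refl
             (qBinom q m k) F G (F ⁻¹) (pow x k) (pow q (l C 2)) (pow (- q) l) (pow x l) (G ⁻¹) ⟩
      (F * F ⁻¹) * (G * G ⁻¹) * (qCoeff q m k * (pow x k * pow x l))
        ≈⟨ *-congʳ (*-cong (⁻¹-inverse F (qfact≉0 k)) (⁻¹-inverse G (qfact≉0 l))) ⟩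
      1# * 1# * (qCoeff q m k * (pow x k * pow x l))
        ≈⟨ trans (*-congʳ (*-identityˡ 1#)) (*-identityˡ _) ⟩
      qCoeff q m k * (pow x k * pow x l)
        ≈⟨ *-congˡ (pow-+ x k l) ⟨
      qCoeff q m k * pow x (k ℕ.+ l)
        ≡⟨ ≡.cong (λ e → qCoeff q m k * pow x e) (ℕ.m+[n∸m]≡n k≤m) ⟩
      qCoeff q m k * pow x m ∎
      where
      l = m ∸ k
      F = qfact q k
      G = qfact q l
      -qx^l : pow (- (q * x)) l ≈ pow (- q) l * pow x l
      -qx^l = trans (pow-cong l (-‿distribˡ-* q x)) (pow-* (- q) x l)

    rhsCoeff-sum : ∀ a b n m → sumTo (rhsCoeff q a b n m) m ≈ pow a m
    rhsCoeff-sum a b n m = *-cancelˡ (qfact≉0 m) (begin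
      qfact q m * sumTo (rhsCoeff q a b n m) m             ≈⟨ *-distribˡ-sumTo _ _ m ⟩
      sumTo (λ k → qfact q m * rhsCoeff q a b n m k) m    ≈⟨ sumTo-cong m (λ k k≤m → qfact-*-Eseries (γ k) k≤m) ⟩
      sumTo (λ k → qCoeff q m k * pow (γ k) m) m          ≈⟨ qDiff-expansion q m _ ⟨
      qDiff q m (λ k → pow (γ k) m)                       ≈⟨ qDiff-cong q m (λ k → pow-cong m (cc-affine q a b n k)) ⟩
      qDiff q m (λ k → pow (α + β * pow q k) m)           ≈⟨ qDiff-pow-affine q α β m ⟩
      pow α m * qProduct q 1# m                           ≈⟨ *-congʳ (pow-* a ι m) ⟩
      (pow a m * pow ι m) * qProduct q 1# m               ≈⟨ *-assoc _ _ _ ⟩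
      pow a m * (pow ι m * qProduct q 1# m)               ≈⟨ *-congˡ (qProduct-1# q m) ⟩
      pow a m * qfact q m                                 ≈⟨ *-comm _ _ ⟩
      qfact q m * pow a m                                 ∎)
      where
      γ = cc q n a b
      ι = (1# - q) ⁻¹
      α = a * ι
      β = pow q n * (b - α)

mainTheorem14 : ∀ {c ℓ} (K : Field c ℓ) → let open FPS K in
    (q : Carrier) → ¬ (q ≈ 0#) → (∀ (m : ℕ) → ¬ (pow q (suc m) ≈ 1#)) →
    (a b : Carrier) (n : ℕ) →
    ∀ (N : ℕ) → ((rhs q n a b) ⊛ (oneMinus a)) N ≈ zpow n N
mainTheorem14 K q _ q-not-root-of-unity a b n =
  ⊛-oneMinus-shifted-geometric K a (FPS.rhs K q n a b) n (rhs-below K q a b n)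
    (λ m → Field.trans K (rhs-above K q a b n m) (rhsCoeff-sum K q-not-root-of-unity a b n m))
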